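{- (Cassini's identity) Let $k>0$ be a real number. For every integer $n\ge1$, $$Q_{P_{k,n-1}}\,Q_{P_{k,n+1}}-\big(Q_{P_{k,n}}\big)^2=(-1)^n\,k^{n-1}\Big[(1+k)+2\,i+(2k^2+6k+4)\,\varepsilon+(4k+8)\,i\,\varepsilon\Big].$$
   Context: Dual-complex numbers are expressions $x_1+i\,x_2+\varepsilon\,y_1+i\,\varepsilon\,y_2$ with $x_1,x_2,y_1,y_2$ real, forming the commutative ring $\mathbb{C}[\varepsilon]/(\varepsilon^2)$: $i^2=-1$, $\varepsilon\neq 0$, $\varepsilon^2=0$, $(i\varepsilon)^2=0$, $i\varepsilon=\varepsilon i$, with multiplication extended bilinearly. The $k$-Pell numbers are defined by $P_{k,0}=0$, $P_{k,1}=1$, $P_{k,n+1}=2P_{k,n}+kP_{k,n-1}$ for $n\ge1$. The dual-complex $k$-Pell quaternion is $Q_{P_{k,n}}=P_{k,n}+i\,P_{k,n+1}+\varepsilon\,P_{k,n+2}+i\,\varepsilon\,P_{k,n+3}$. -}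

module Defs where

open import Level using (_⊔_)
open import Data.Nat using (ℕ; zero; suc)
open import Algebra.Bundles using (CommutativeRing)

-- Dual-complex numbers and k-Pell quaternions over an arbitrary
-- commutative ring R (instantiate R := ℝ for the paper's setting).
module DualComplex {c ℓ} (R : CommutativeRing c ℓ) where
  open CommutativeRing R

  -- x₁ + i x₂ + ε y₁ + i ε y₂
  record DC : Set c where
    constructor dc
    field
      x₁ x₂ y₁ y₂ : Carrier
  open DC public

  record _≈D_ (p q : DC) : Set ℓ where
    constructor eqD
    field
      ≈x₁ : x₁ p ≈ x₁ q
      ≈x₂ : x₂ p ≈ x₂ q
      ≈y₁ : y₁ p ≈ y₁ q
      ≈y₂ : y₂ p ≈ y₂ q

  infixl 6 _+D_ _-D_
  infixl 7 _*D_ _·D_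
  infix 4 _≈D_

  _+D_ : DC → DC → DC
  dc a b c' d +D dc a' b' c'' d' = dc (a + a') (b + b') (c' + c'') (d + d')

  -D_ : DC → DC
  -D dc a b c' d = dc (- a) (- b) (- c') (- d)

  _-D_ : DC → DC → DC
  p -D q = p +D (-D q)

  -- multiplication with i² = -1, ε² = 0, (iε)² = 0, iε = εi, bilinear
  _*D_ : DC → DC → DC
  dc a b c' d *D dc a' b' c'' d' =
    dc (a * a' - b * b')
       (a * b' + b * a')
       (a * c'' + c' * a' - (b * d' + d * b'))
       (a * d' + d * a' + (b * c'' + c' * b'))

  _·D_ : Carrier → DC → DC
  r ·D dc a b c' d = dc (r * a) (r * b) (r * c') (r * d)

  fromℕ : ℕ → Carrier
  fromℕ zero = 0#
  fromℕ (suc n) = 1# + fromℕ n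

  _^R_ : Carrier → ℕ → Carrier
  x ^R zero = 1#
  x ^R suc n = x * (x ^R n)

  Pell : Carrier → ℕ → Carrier
  Pell k zero = 0#
  Pell k (suc zero) = 1#
  Pell k (suc (suc n)) = fromℕ 2 * Pell k (suc n) + k * Pell k n

  QP : Carrier → ℕ → DC
  QP k n = dc (Pell k n) (Pell k (suc n)) (Pell k (suc (suc n))) (Pell k (suc (suc (suc n))))

-- Write D(m) = Q(m) Q(m+2) − Q(m+1)² for the Cassini defect of the sequence
-- Q(m) = QP k m.  The proof has two mathematical ingredients:
--   * a recurrence D(m+1) = −k D(m), valid for every sequence obeying the
--     k-Pell recurrence x(j+2) = 2 x(j+1) + k x(j) whatever its initial values;
--   * the initial value D(0) = −V(k), where V(k) is the dual-complex number
--     on the right-hand side of the theorem.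
-- Induction then gives D(m) = (−1)^(m+1) k^m V(k), which is the theorem for n = m+1.
--
-- Both ingredients are polynomial identities over an arbitrary commutative
-- ring, verified by normalisation: polynomial expressions with integer
-- coefficients (formal differences of naturals) form a commutative ring, so
-- the dual-complex operations of Defs can be run on symbolic entries and both
-- sides compared through the normal forms of the library's ring solver.
module Submission where

open import Algebra.Bundles using (CommutativeRing; RawRing)
open import Level using (0ℓ; _⊔_)
open import Algebra.Solver.Ring.AlmostCommutativeRing
  using (fromCommutativeRing; _-Raw-AlmostCommutative⟶_)
import Algebra.Solver.Ring as RingSolver
open import Data.Fin using (#_)
open import Data.Maybe as Maybe using (Maybe; nothing; just; From-just; from-just)
open import Data.Nat as ℕ using (ℕ; zero; suc)
import Data.Nat.Properties as ℕₚ
open import Data.Product using (_,_) renaming (_×_ to _⊗_)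
open import Data.Vec using ([]; _∷_)
open import Relation.Binary.Bundles using (Setoid)
open import Relation.Binary.PropositionalEquality as ≡ using (_≡_)
open import Relation.Nullary using (yes; no)
open import Defs

module PellSequences {c ℓ} (R : CommutativeRing c ℓ) where
  open CommutativeRing R
  open DualComplex R

  -- For every m, Pell k (j + m) unfolds definitionally to
  -- pellFrom k (Pell k m) (Pell k (suc m)) j when j is a numeral.
  pellFrom : (k a b : Carrier) → ℕ → Carrier
  pellFrom k a b zero = a
  pellFrom k a b (suc zero) = b
  pellFrom k a b (suc (suc j)) = fromℕ 2 * pellFrom k a b (suc j) + k * pellFrom k a b j

  quatFrom : (k a b : Carrier) → ℕ → DC
  quatFrom k a b j =
    dc (pellFrom k a b j) (pellFrom k a b (suc j)) (pellFrom k a b (suc (suc j))) (pellFrom k a b (suc (suc (suc j))))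

  cassiniDefect : (ℕ → DC) → ℕ → DC
  cassiniDefect Q m = Q m *D Q (suc (suc m)) -D Q (suc m) *D Q (suc m)

  cassiniScalar : Carrier → ℕ → Carrier
  cassiniScalar k m = (- 1#) ^R suc m * k ^R m

  cassiniVector : Carrier → DC
  cassiniVector k =
    dc (1# + k) (fromℕ 2) (fromℕ 2 * (k * k) + fromℕ 6 * k + fromℕ 4) (fromℕ 4 * k + fromℕ 8)

module DualComplexAlgebra {c ℓ} (R : CommutativeRing c ℓ) where
  open CommutativeRing R
  open DualComplex R

  ≈D-setoid : Setoid c ℓ
  ≈D-setoid = record
    { Carrier = DC
    ; _≈_ = _≈D_
    ; isEquivalence = record
      { refl = eqD refl refl refl refl
      ; sym = λ { (eqD e₁ e₂ e₃ e₄) → eqD (sym e₁) (sym e₂) (sym e₃) (sym e₄) }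
      ; trans = λ { (eqD e₁ e₂ e₃ e₄) (eqD f₁ f₂ f₃ f₄) →
                    eqD (trans e₁ f₁) (trans e₂ f₂) (trans e₃ f₃) (trans e₄ f₄) }
      }
    }

  ·D-assoc : ∀ r s p → r ·D (s ·D p) ≈D (r * s) ·D p
  ·D-assoc r s (dc a b c′ d) =
    eqD (sym (*-assoc r s a)) (sym (*-assoc r s b)) (sym (*-assoc r s c′)) (sym (*-assoc r s d))

  ·D-congˡ : ∀ {r s} p → r ≈ s → r ·D p ≈D s ·D p
  ·D-congˡ (dc a b c′ d) r≈s = eqD (*-congʳ r≈s) (*-congʳ r≈s) (*-congʳ r≈s) (*-congʳ r≈s)

  ·D-congʳ : ∀ r {p q} → p ≈D q → r ·D p ≈D r ·D q
  ·D-congʳ r (eqD e₁ e₂ e₃ e₄) = eqD (*-congˡ e₁) (*-congˡ e₂) (*-congˡ e₃) (*-congˡ e₄)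

-- Formal differences p − q of natural numbers, used as the coefficient ring
-- of the solver: they denote integers in any ring, and their equality is
-- decidable by comparing cross sums.
Diff : Set
Diff = ℕ ⊗ ℕ

DiffRing : RawRing 0ℓ 0ℓ
DiffRing = record
  { Carrier = Diff
  ; _≈_ = _≡_
  ; _+_ = λ { (p , q) (r , s) → (p ℕ.+ r , q ℕ.+ s) }
  ; _*_ = λ { (p , q) (r , s) → (p ℕ.* r ℕ.+ q ℕ.* s , p ℕ.* s ℕ.+ q ℕ.* r) }
  ; -_ = λ { (p , q) → (q , p) }
  ; 0# = (0 , 0)
  ; 1# = (1 , 0)
  }

module IntegerSolver {c ℓ} (R : CommutativeRing c ℓ) where
  open CommutativeRing R
  open import Algebra.Properties.Ring ring
    using (-‿+-comm; -0#≈0#; ⁻¹-anti-homo‿-; x[y-z]≈xy-xz; [y-z]x≈yx-zx)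
  open import Algebra.Properties.CommutativeSemigroup +-commutativeSemigroup using (interchange)
  open import Algebra.Properties.Semiring.Mult.TCOptimised semiring using (_×_; ×-homo-+; ×1-homo-*)
  open import Relation.Binary.Reasoning.Setoid setoid

  sum-of-differences : ∀ a b c d → (a - c) + (b - d) ≈ (a + b) - (c + d)
  sum-of-differences a b c d = begin
    (a - c) + (b - d)       ≈⟨ interchange a (- c) b (- d) ⟩
    (a + b) + (- c + - d)   ≈⟨ +-congˡ (-‿+-comm c d) ⟩
    (a + b) - (c + d)       ∎

  product-of-differences : ∀ a b c d → (a - b) * (c - d) ≈ (a * c + b * d) - (a * d + b * c)
  product-of-differences a b c d = begin
    (a - b) * (c - d)                  ≈⟨ [y-z]x≈yx-zx (c - d) a b ⟩
    a * (c - d) - b * (c - d)          ≈⟨ +-cong (x[y-z]≈xy-xz a c d) (-‿cong (x[y-z]≈xy-xz b c d)) ⟩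
    (a * c - a * d) - (b * c - b * d)  ≈⟨ +-congˡ (⁻¹-anti-homo‿- (b * c) (b * d)) ⟩
    (a * c - a * d) + (b * d - b * c)  ≈⟨ sum-of-differences (a * c) (b * d) (a * d) (b * c) ⟩
    (a * c + b * d) - (a * d + b * c)  ∎

  difference-cong : ∀ {a b c d} → a + d ≈ c + b → a - b ≈ c - d
  difference-cong {a} {b} {c} {d} a+d≈c+b = begin
    a - b              ≈⟨ sym (+-identityʳ (a - b)) ⟩
    (a - b) + 0#       ≈⟨ +-congˡ (sym (-‿inverseʳ d)) ⟩
    (a - b) + (d - d)  ≈⟨ sum-of-differences a d b d ⟩
    (a + d) - (b + d)  ≈⟨ +-cong a+d≈c+b (-‿cong (+-comm b d)) ⟩
    (c + b) - (d + b)  ≈⟨ sym (sum-of-differences c b d b) ⟩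
    (c - d) + (b - b)  ≈⟨ +-congˡ (-‿inverseʳ b) ⟩
    (c - d) + 0#       ≈⟨ +-identityʳ (c - d) ⟩
    c - d              ∎

  ι : ℕ → Carrier
  ι p = p × 1#

  ι-homo-+ : ∀ p q → ι (p ℕ.+ q) ≈ ι p + ι q
  ι-homo-+ = ×-homo-+ 1#

  -- Denotation of a formal difference.  The case q = 0 is treated apart so
  -- that the coefficients 0 and 1 denote 0# and 1# definitionally.
  ⟦_⟧ᵈ : Diff → Carrier
  ⟦ p , zero ⟧ᵈ = ι p
  ⟦ p , suc q ⟧ᵈ = ι p - ι (suc q)

  ⟦⟧ᵈ-difference : ∀ p q → ⟦ p , q ⟧ᵈ ≈ ι p - ι q
  ⟦⟧ᵈ-difference p zero = sym (trans (+-congˡ -0#≈0#) (+-identityʳ (ι p)))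
  ⟦⟧ᵈ-difference p (suc q) = refl

  diffHomomorphism : DiffRing -Raw-AlmostCommutative⟶ fromCommutativeRing R
  diffHomomorphism = record
    { ⟦_⟧ = ⟦_⟧ᵈ
    ; +-homo = λ { (p , q) (r , s) → begin
        ⟦ p ℕ.+ r , q ℕ.+ s ⟧ᵈ      ≈⟨ ⟦⟧ᵈ-difference (p ℕ.+ r) (q ℕ.+ s) ⟩
        ι (p ℕ.+ r) - ι (q ℕ.+ s)   ≈⟨ +-cong (ι-homo-+ p r) (-‿cong (ι-homo-+ q s)) ⟩
        (ι p + ι r) - (ι q + ι s)   ≈⟨ sym (sum-of-differences (ι p) (ι r) (ι q) (ι s)) ⟩
        (ι p - ι q) + (ι r - ι s)   ≈⟨ sym (+-cong (⟦⟧ᵈ-difference p q) (⟦⟧ᵈ-difference r s)) ⟩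
        ⟦ p , q ⟧ᵈ + ⟦ r , s ⟧ᵈ     ∎ }
    ; *-homo = λ { (p , q) (r , s) → begin
        ⟦ p ℕ.* r ℕ.+ q ℕ.* s , p ℕ.* s ℕ.+ q ℕ.* r ⟧ᵈ
          ≈⟨ ⟦⟧ᵈ-difference (p ℕ.* r ℕ.+ q ℕ.* s) (p ℕ.* s ℕ.+ q ℕ.* r) ⟩
        ι (p ℕ.* r ℕ.+ q ℕ.* s) - ι (p ℕ.* s ℕ.+ q ℕ.* r)
          ≈⟨ +-cong (trans (ι-homo-+ (p ℕ.* r) (q ℕ.* s)) (+-cong (×1-homo-* p r) (×1-homo-* q s)))
                    (-‿cong (trans (ι-homo-+ (p ℕ.* s) (q ℕ.* r)) (+-cong (×1-homo-* p s) (×1-homo-* q r)))) ⟩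
        (ι p * ι r + ι q * ι s) - (ι p * ι s + ι q * ι r)
          ≈⟨ sym (product-of-differences (ι p) (ι q) (ι r) (ι s)) ⟩
        (ι p - ι q) * (ι r - ι s)
          ≈⟨ sym (*-cong (⟦⟧ᵈ-difference p q) (⟦⟧ᵈ-difference r s)) ⟩
        ⟦ p , q ⟧ᵈ * ⟦ r , s ⟧ᵈ ∎ }
    ; -‿homo = λ { (p , q) → begin
        ⟦ q , p ⟧ᵈ     ≈⟨ ⟦⟧ᵈ-difference q p ⟩
        ι q - ι p      ≈⟨ sym (⁻¹-anti-homo‿- (ι p) (ι q)) ⟩
        - (ι p - ι q)  ≈⟨ -‿cong (sym (⟦⟧ᵈ-difference p q)) ⟩
        - ⟦ p , q ⟧ᵈ   ∎ }
    ; 0-homo = refl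
    ; 1-homo = refl
    }

  diff≟ : ∀ x y → Maybe (⟦ x ⟧ᵈ ≈ ⟦ y ⟧ᵈ)
  diff≟ (p , q) (r , s) with p ℕ.+ s ℕ.≟ r ℕ.+ q
  ... | no _ = nothing
  ... | yes p+s≡r+q = just (begin
    ⟦ p , q ⟧ᵈ  ≈⟨ ⟦⟧ᵈ-difference p q ⟩
    ι p - ι q   ≈⟨ difference-cong (begin
                     ι p + ι s    ≈⟨ sym (ι-homo-+ p s) ⟩
                     ι (p ℕ.+ s)  ≡⟨ ≡.cong ι p+s≡r+q ⟩
                     ι (r ℕ.+ q)  ≈⟨ ι-homo-+ r q ⟩
                     ι r + ι q    ∎) ⟩
    ι r - ι s   ≈⟨ sym (⟦⟧ᵈ-difference r s) ⟩
    ⟦ r , s ⟧ᵈ  ∎)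

  open RingSolver DiffRing (fromCommutativeRing R) diffHomomorphism diff≟ public

  normal-forms-agree : ∀ {n} (p q : Polynomial n) → normalise p ≈N normalise q →
                       ∀ ρ → ⟦ p ⟧ ρ ≈ ⟦ q ⟧ ρ
  normal-forms-agree p q p≈q ρ = trans (sym (correct p ρ)) (trans (⟦ p≈q ⟧N-cong ρ) (correct q ρ))

-- Polynomial expressions in n variables over R, identified when they denote
-- the same function of the variables, form a commutative ring: denotation is
-- by construction an injective ring homomorphism into the pointwise ring of
-- functions, along which the laws are transported.
module Symbolic {c ℓ} (R : CommutativeRing c ℓ) (n : ℕ) where
  open IntegerSolver R
  open CommutativeRing R using (_≈_; refl)
  open import Algebra.Morphism.Structures using (IsRingMonomorphism)
  import Algebra.Morphism.RingMonomorphism as RingMonomorphism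
  import Algebra.Construct.Pointwise as Pointwise

  functionRing : CommutativeRing c (c ⊔ ℓ)
  functionRing = Pointwise.commutativeRing (Env n) R

  rawExpressionRing : RawRing 0ℓ (c ⊔ ℓ)
  rawExpressionRing = record
    { Carrier = Polynomial n
    ; _≈_ = λ p q → ∀ ρ → ⟦ p ⟧ ρ ≈ ⟦ q ⟧ ρ
    ; _+_ = _:+_
    ; _*_ = _:*_
    ; -_ = :-_
    ; 0# = con (0 , 0)
    ; 1# = con (1 , 0)
    }

  denotation-isMonomorphism :
    IsRingMonomorphism rawExpressionRing (CommutativeRing.rawRing functionRing) ⟦_⟧
  denotation-isMonomorphism = record
    { isRingHomomorphism = record
      { isSemiringHomomorphism = record
        { isNearSemiringHomomorphism = record
          { +-isMonoidHomomorphism = record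
            { isMagmaHomomorphism = record
              { isRelHomomorphism = record { cong = λ p≈q → p≈q }
              ; homo = λ _ _ _ → refl
              }
            ; ε-homo = λ _ → refl
            }
          ; *-homo = λ _ _ _ → refl
          }
        ; 1#-homo = λ _ → refl
        }
      ; -‿homo = λ _ _ → refl
      }
    ; injective = λ p≈q → p≈q
    }

  expressionRing : CommutativeRing 0ℓ (c ⊔ ℓ)
  expressionRing = record
    { isCommutativeRing = RingMonomorphism.isCommutativeRing denotation-isMonomorphism
                            (CommutativeRing.isCommutativeRing functionRing) }

  module D = DualComplex R

  module E where
    open CommutativeRing expressionRing public using (Carrier; -_)
    open DualComplex expressionRing public
    open PellSequences expressionRing public
    open IntegerSolver R public using (var)

  -- Entrywise denotation of a dual-complex number with symbolic entries.  It
  -- commutes definitionally with every operation of Defs, since those are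
  -- built from the ring operations only.
  ⟦_⟧DC : E.DC → Env n → D.DC
  ⟦ E.dc a b c d ⟧DC ρ = D.dc (⟦ a ⟧ ρ) (⟦ b ⟧ ρ) (⟦ c ⟧ ρ) (⟦ d ⟧ ρ)

  _≟_ : (p q : Polynomial n) → Maybe (∀ ρ → ⟦ p ⟧ ρ ≈ ⟦ q ⟧ ρ)
  p ≟ q = Maybe.map (normal-forms-agree p q) (normalise p ≟N normalise q)

  _≟DC_ : (p q : E.DC) → Maybe (∀ ρ → ⟦ p ⟧DC ρ D.≈D ⟦ q ⟧DC ρ)
  E.dc a b c d ≟DC E.dc a′ b′ c′ d′ with a ≟ a′ | b ≟ b′ | c ≟ c′ | d ≟ d′
  ... | just a≈a′ | just b≈b′ | just c≈c′ | just d≈d′ = just (λ ρ → D.eqD (a≈a′ ρ) (b≈b′ ρ) (c≈c′ ρ) (d≈d′ ρ))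
  ... | _         | _         | _         | _         = nothing

  -- For concrete symbolic expressions the comparison runs during type checking:
  -- the type of by-normalisation p q reduces to ∀ ρ → ⟦ p ⟧DC ρ ≈D ⟦ q ⟧DC ρ
  -- exactly when p and q have the same normal forms.
  by-normalisation : (p q : E.DC) → From-just (p ≟DC q)
  by-normalisation p q = from-just (p ≟DC q)

module CassiniProof {c ℓ} (R : CommutativeRing c ℓ) where
  open CommutativeRing R
  open DualComplex R
  open DualComplexAlgebra R
  open PellSequences R
  open import Algebra.Properties.Ring ring using (-‿distribˡ-*; -1*x≈-x)
  open import Algebra.Properties.CommutativeSemigroup *-commutativeSemigroup using (x∙yz≈y∙xz)

  cassini-recurrence : ∀ k a b →
    cassiniDefect (quatFrom k a b) 1 ≈D (- k) ·D cassiniDefect (quatFrom k a b) 0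
  cassini-recurrence k a b =
    S.by-normalisation (E.cassiniDefect (E.quatFrom κ α β) 1)
                       ((E.- κ) E.·D E.cassiniDefect (E.quatFrom κ α β) 0)
                       (k ∷ a ∷ b ∷ [])
    where
    module S = Symbolic R 3
    module E = S.E
    κ α β : E.Carrier
    κ = E.var (# 0)
    α = E.var (# 1)
    β = E.var (# 2)

  cassini-initial : ∀ k → cassiniDefect (QP k) 0 ≈D cassiniScalar k 0 ·D cassiniVector k
  cassini-initial k =
    S.by-normalisation (E.cassiniDefect (E.QP κ) 0)
                       (E.cassiniScalar κ 0 E.·D E.cassiniVector κ)
                       (k ∷ [])
    where
    module S = Symbolic R 1
    module E = S.E
    κ : E.Carrier
    κ = E.var (# 0)

  cassiniScalar-step : ∀ k m → - k * cassiniScalar k m ≈ cassiniScalar k (suc m)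
  cassiniScalar-step k m = begin
    - k * (u * w)         ≈⟨ sym (-‿distribˡ-* k (u * w)) ⟩
    - (k * (u * w))       ≈⟨ -‿cong (x∙yz≈y∙xz k u w) ⟩
    - (u * (k * w))       ≈⟨ -‿distribˡ-* u (k * w) ⟩
    - u * (k * w)         ≈⟨ *-congʳ (sym (-1*x≈-x u)) ⟩
    (- 1# * u) * (k * w)  ∎
    where
    open import Relation.Binary.Reasoning.Setoid setoid
    u w : Carrier
    u = (- 1#) ^R suc m
    w = k ^R m

  -- In the inductive step the
  -- quaternions QP k (j + m) unfold to quatFrom k (Pell k m) (Pell k (suc m)) j,
  -- so the general recurrence applies directly.
  cassini-closed-form : ∀ k m → cassiniDefect (QP k) m ≈D cassiniScalar k m ·D cassiniVector k
  cassini-closed-form k zero = cassini-initial k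
  cassini-closed-form k (suc m) = begin
    cassiniDefect (QP k) (suc m)                    ≈⟨ cassini-recurrence k (Pell k m) (Pell k (suc m)) ⟩
    (- k) ·D cassiniDefect (QP k) m                 ≈⟨ ·D-congʳ (- k) (cassini-closed-form k m) ⟩
    (- k) ·D (cassiniScalar k m ·D cassiniVector k)  ≈⟨ ·D-assoc (- k) (cassiniScalar k m) (cassiniVector k) ⟩
    (- k * cassiniScalar k m) ·D cassiniVector k    ≈⟨ ·D-congˡ (cassiniVector k) (cassiniScalar-step k m) ⟩
    cassiniScalar k (suc m) ·D cassiniVector k      ∎
    where open import Relation.Binary.Reasoning.Setoid ≈D-setoid

open import Data.Nat using (_≤_; _∸_; _+_; s≤s)

mainTheorem5 : ∀ {c ℓ} (R : CommutativeRing c ℓ) →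
    let open CommutativeRing R renaming (_+_ to _+R_) in
    let open DualComplex R in
    (k : Carrier) (n : ℕ) → 1 ≤ n →
      QP k (n ∸ 1) *D QP k (n + 1) -D QP k n *D QP k n
        ≈D (((- 1#) ^R n) * (k ^R (n ∸ 1)))
           ·D dc (1# +R k)
                 (fromℕ 2)
                 (fromℕ 2 * (k * k) +R fromℕ 6 * k +R fromℕ 4)
                 (fromℕ 4 * k +R fromℕ 8)
mainTheorem5 R k (suc m) (s≤s _) rewrite ℕₚ.+-comm m 1 = CassiniProof.cassini-closed-form R k m
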